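{- For every positive integer $n$, $$ex_v(\overrightarrow{V_2},\overrightarrow{Q_n})=2^{n-1}+1.$$
   Context: The oriented hypercube $\overrightarrow{Q_n}$ has vertex set $\{0,1\}^n$ (identified with the subsets of $[n]$); for every $A\subseteq[n]$ and $x\notin A$ there is a directed edge from $A$ to $A\cup\{x\}$, and no other edges. $\overrightarrow{V_2}$ is the oriented path $abc$ in which the edge $ab$ is directed from $b$ to $a$ and the edge $bc$ is directed from $b$ to $c$ (the middle vertex is a source). For an oriented graph $\overrightarrow{F}$, $ex_v(\overrightarrow{F},\overrightarrow{Q_n})$ is the maximum size of a vertex subset $U$ of $\overrightarrow{Q_n}$ such that the induced subgraph $\overrightarrow{Q_n}[U]$ contains no subgraph isomorphic to $\overrightarrow{F}$ as a directed graph. -}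

module Defs where

open import Data.Nat using (ℕ; _≤_)
open import Data.Bool using (Bool; true; false)
open import Data.Fin using (Fin; zero; suc)
open import Data.Vec using (Vec; lookup; _[_]≔_)
open import Data.List using (List; length)
open import Data.List.Membership.Propositional using (_∈_)
open import Data.List.Relation.Unary.Unique.Propositional using (Unique)
open import Data.Product using (Σ; _×_; ∃)
open import Relation.Binary.PropositionalEquality using (_≡_)
open import Relation.Nullary using (¬_)
open import Function.Definitions using (Injective)
open import Data.Unit using (⊤)
open import Data.Empty using (⊥)

-- Vertices of the oriented hypercube Q_n: characteristic vectors of subsets of [n].
Vertex : ℕ → Set
Vertex n = Vec Bool n

-- Directed edge A → A ∪ {x} for x ∉ A.
Arc : ∀ {n} → Vertex n → Vertex n → Set
Arc {n} A B = Σ (Fin n) λ x → (lookup A x ≡ false) × (B ≡ A [ x ]≔ true)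

record OrientedGraph : Set₁ where
  field
    size : ℕ
    E    : Fin size → Fin size → Set

-- V_2 : vertices a = 0, b = 1, c = 2; arcs b → a and b → c.
V2-arc : Fin 3 → Fin 3 → Set
V2-arc (suc zero) zero = ⊤
V2-arc (suc zero) (suc (suc zero)) = ⊤
V2-arc _ _ = ⊥

V2 : OrientedGraph
V2 = record { size = 3 ; E = V2-arc }

ContainsCopy : (F : OrientedGraph) → ∀ {n} → List (Vertex n) → Set
ContainsCopy F {n} U =
  Σ (Fin (OrientedGraph.size F) → Vertex n) λ f →
    Injective _≡_ _≡_ f ×
    (∀ i → f i ∈ U) ×
    (∀ i j → OrientedGraph.E F i j → Arc (f i) (f j))

FFree : (F : OrientedGraph) → ∀ {n} → List (Vertex n) → Set
FFree F U = Unique U × ¬ ContainsCopy F U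

ExV≡ : OrientedGraph → ℕ → ℕ → Set
ExV≡ F n m =
  (Σ (List (Vertex n)) λ U → FFree F U × length U ≡ m) ×
  (∀ (U : List (Vertex n)) → FFree F U → length U ≤ m)

-- A V₂-free family U contains no vertex with two out-neighbours in U. Splitting the cube
-- along a coordinate, induction gives the sharper bound |U| + 1 ≤ 2ⁿ⁻¹ + [top ∈ U] +
-- [U meets the coatoms]: one chooses a coordinate i whose coatom is missing from U, or,
-- if U contains every coatom, i = 0, since then the lower half contains no coatom of its
-- own (a vertex with two zeros, one of them at 0, would have two out-neighbours among the
-- coatoms). Conversely the top vertex together with the parity class of its out-neighbours
-- is V₂-free: an arc flips parity, so the only arcs inside it end at the top.
module Submission where

open import Defs
open import Data.Nat using (ℕ; zero; suc; _+_; _*_; _^_; _≤_; z≤n)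
open import Data.Nat.Properties
  using (+-comm; +-suc; +-identityʳ; +-mono-≤; +-monoʳ-≤; +-cancelʳ-≤; ≤-trans; ≤-refl; module ≤-Reasoning;
         +-commutativeSemigroup)
open import Data.Nat.Tactic.RingSolver using (solve)
open import Algebra.Properties.CommutativeSemigroup +-commutativeSemigroup using (interchange)
open import Data.Bool using (Bool; true; false; not; _xor_; T)
open import Data.Bool.Properties using (not-involutive; not-¬) renaming (_≟_ to _≟ᵇ_)
open import Data.Fin using (Fin; zero; suc; punchIn)
open import Data.Fin.Properties using (any?; all?; ¬∀⟶∃¬)
open import Data.Vec using (Vec; []; _∷_; lookup; _[_]≔_; insertAt; removeAt; replicate)
open import Data.Vec.Properties
  using (≡-dec; lookup∘update; []≔-idempotent; []≔-lookup; lookup-replicate;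
         insertAt-punchIn; removeAt-insertAt; ∷-injectiveʳ)
open import Data.List as List using (List; []; _∷_; length; map; _++_)
open import Data.List.Properties using (length-++; length-map)
open import Data.List.Membership.Propositional using (_∈_)
open import Data.List.Membership.Propositional.Properties using (∈-map⁻; ∈-++⁻)
import Data.List.Membership.DecPropositional as DecMembership
open import Data.List.Relation.Unary.Any using (here; there)
import Data.List.Relation.Unary.All as All
open import Data.List.Relation.Unary.All.Properties using (All¬⇒¬Any)
open import Data.List.Relation.Unary.AllPairs using (_∷_; [])
open import Data.List.Relation.Unary.Unique.Propositional using (Unique)
open import Data.List.Relation.Unary.Unique.Propositional.Properties using (map⁺; ++⁺)
open import Data.Product using (_×_; ∃; _,_)
open import Data.Sum using (_⊎_; inj₁; inj₂)
open import Data.Unit using (tt)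
open import Data.Empty using (⊥)
open import Function using (_∘_)
open import Relation.Binary.PropositionalEquality
open import Relation.Nullary using (¬_; Dec; does; yes; no; contradiction)
open import Relation.Nullary.Decidable using (T?)

private
  variable
    n : ℕ

χ : ∀ {a} {A : Set a} → Dec A → ℕ
χ (yes _) = 1
χ (no _)  = 0

χ≤1 : ∀ {a} {A : Set a} (a? : Dec A) → χ a? ≤ 1
χ≤1 (yes _) = ≤-refl
χ≤1 (no _)  = z≤n

χ-mono : ∀ {a b} {A : Set a} {B : Set b} → (A → B) → (a? : Dec A) (b? : Dec B) → χ a? ≤ χ b?
χ-mono f (yes a) (yes _) = ≤-refl
χ-mono f (yes a) (no ¬b) = contradiction (f a) ¬b
χ-mono f (no _)  b?      = z≤n

χ-no : ∀ {a} {A : Set a} → ¬ A → (a? : Dec A) → χ a? ≤ 0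
χ-no ¬a (yes a) = contradiction a ¬a
χ-no ¬a (no _)  = z≤n

χ-yes : ∀ {a} {A : Set a} → A → (a? : Dec A) → 1 ≤ χ a?
χ-yes a (yes _)  = ≤-refl
χ-yes a (no ¬a) = contradiction a ¬a

module _ {a} {A : Set a} where

  insertAt-[]≔ : ∀ {n} (v : Vec A n) (i : Fin (suc n)) (x y : A) (j : Fin n) →
                 insertAt (v [ j ]≔ y) i x ≡ insertAt v i x [ punchIn i j ]≔ y
  insertAt-[]≔ v        zero    x y j       = refl
  insertAt-[]≔ (u ∷ v) (suc i) x y zero    = refl
  insertAt-[]≔ (u ∷ v) (suc i) x y (suc j) = cong (u ∷_) (insertAt-[]≔ v i x y j)

  insertAt-replicate : ∀ {n} (i : Fin (suc n)) (x y : A) →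
                       insertAt (replicate n x) i y ≡ replicate (suc n) x [ i ]≔ y
  insertAt-replicate         zero    x y = refl
  insertAt-replicate {suc n} (suc i) x y = cong (x ∷_) (insertAt-replicate i x y)

  replicate-[]≔ : ∀ {n} (i : Fin n) (x : A) → replicate n x [ i ]≔ x ≡ replicate n x
  replicate-[]≔ {n} i x =
    trans (cong (replicate n x [ i ]≔_) (sym (lookup-replicate i x))) ([]≔-lookup (replicate n x) i)

  insertAt-injective : ∀ {n} (i : Fin (suc n)) (x : A) {v w : Vec A n} →
                       insertAt v i x ≡ insertAt w i x → v ≡ w
  insertAt-injective i x {v} {w} eq =
    trans (sym (removeAt-insertAt v i x)) (trans (cong (λ u → removeAt u i) eq) (removeAt-insertAt w i x))

top : ∀ n → Vertex n
top n = replicate n true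

coatom : Fin n → Vertex n
coatom {n} j = top n [ j ]≔ false

insertAt-top : (i : Fin (suc n)) → insertAt (top n) i true ≡ top (suc n)
insertAt-top i = trans (insertAt-replicate i true true) (replicate-[]≔ i true)

insertAt-coatom : (i : Fin (suc n)) (j : Fin n) →
                  insertAt (coatom j) i true ≡ coatom (punchIn i j)
insertAt-coatom {n} i j =
  trans (insertAt-[]≔ (top n) i true false j) (cong (_[ punchIn i j ]≔ false) (insertAt-top i))

Arc⇒≢ : {A B : Vertex n} → Arc A B → A ≢ B
Arc⇒≢ {A = A} (x , Ax≡false , refl) A≡B =
  not-¬ refl (trans (sym Ax≡false) (trans (cong (λ v → lookup v x) A≡B) (lookup∘update x A true)))

top-no-Arc : {B : Vertex n} → ¬ Arc (top n) B
top-no-Arc (x , topx≡false , _) = not-¬ refl (trans (sym (lookup-replicate x true)) topx≡false)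

Arc-insertAt : (i : Fin (suc n)) (b : Bool) {A B : Vertex n} →
               Arc A B → Arc (insertAt A i b) (insertAt B i b)
Arc-insertAt i b {A} (x , Ax≡false , refl) =
  punchIn i x , trans (insertAt-punchIn A i b x) Ax≡false , insertAt-[]≔ A i b true x

parity : Vertex n → Bool
parity []      = false
parity (x ∷ v) = x xor parity v

parity-[]≔true : (v : Vertex n) (j : Fin n) → lookup v j ≡ false →
                 parity (v [ j ]≔ true) ≡ not (parity v)
parity-[]≔true (false ∷ v) zero    _ = refl
parity-[]≔true (false ∷ v) (suc j) e = parity-[]≔true v j e
parity-[]≔true (true ∷ v)  (suc j) e = cong not (parity-[]≔true v j e)

parity-Arc : {A B : Vertex n} → Arc A B → parity B ≡ not (parity A)
parity-Arc {A = A} (x , Ax≡false , refl) = parity-[]≔true A x Ax≡false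

-- Counting vertices

count : (Vertex n → Bool) → ℕ
count {zero}  P = χ (T? (P []))
count {suc n} P = count (λ v → P (false ∷ v)) + count (λ v → P (true ∷ v))

count-cong : {P Q : Vertex n → Bool} → (∀ v → P v ≡ Q v) → count P ≡ count Q
count-cong {zero}  P≗Q = cong (χ ∘ T?) (P≗Q [])
count-cong {suc n} P≗Q = cong₂ _+_ (count-cong (P≗Q ∘ (false ∷_))) (count-cong (P≗Q ∘ (true ∷_)))

count-false : ∀ n → count {n} (λ _ → false) ≡ 0
count-false zero    = refl
count-false (suc n) = cong₂ _+_ (count-false n) (count-false n)

face : (Vertex (suc n) → Bool) → Fin (suc n) → Bool → Vertex n → Bool
face P i b v = P (insertAt v i b)

count-face : (P : Vertex (suc n) → Bool) (i : Fin (suc n)) →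
             count P ≡ count (face P i false) + count (face P i true)
count-face         P zero    = refl
count-face {suc n} P (suc i) =
  trans (cong₂ _+_ (count-face P₀ i) (count-face P₁ i))
        (interchange (count (face P₀ i false)) (count (face P₀ i true))
                     (count (face P₁ i false)) (count (face P₁ i true)))
  where
  P₀ P₁ : Vertex (suc n) → Bool
  P₀ = P ∘ (false ∷_)
  P₁ = P ∘ (true ∷_)

count-remove : (P Q : Vertex n → Bool) (v : Vertex n) → T (P v) → ¬ T (Q v) →
               (∀ w → w ≢ v → Q w ≡ P w) → count P ≡ suc (count Q)
count-remove {zero} P Q [] Pv ¬Qv _ with T? (P []) | T? (Q [])
... | yes _  | no _   = refl
... | no ¬Pv | _      = contradiction Pv ¬Pv
... | yes _  | yes Qv = contradiction Qv ¬Qv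
count-remove {suc n} P Q (false ∷ v) Pv ¬Qv Q≗P =
  cong₂ _+_ (count-remove _ _ v Pv ¬Qv (λ w w≢v → Q≗P (false ∷ w) (w≢v ∘ ∷-injectiveʳ)))
            (count-cong (λ w → sym (Q≗P (true ∷ w) λ ())))
count-remove {suc n} P Q (true ∷ v) Pv ¬Qv Q≗P =
  trans (cong₂ _+_ (count-cong (λ w → sym (Q≗P (false ∷ w) λ ())))
                   (count-remove _ _ v Pv ¬Qv (λ w w≢v → Q≗P (true ∷ w) (w≢v ∘ ∷-injectiveʳ))))
        (+-suc _ _)

module _ {n : ℕ} where
  open DecMembership (≡-dec {n = n} _≟ᵇ_) using (_∈?_)

  member : List (Vertex n) → Vertex n → Bool
  member U w = does (w ∈? U)

  member⇒∈ : ∀ {U w} → T (member U w) → w ∈ U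
  member⇒∈ {U} {w} t with w ∈? U
  ... | yes w∈U = w∈U

  ∈⇒member : ∀ {U w} → w ∈ U → T (member U w)
  ∈⇒member {U} {w} w∈U with w ∈? U
  ... | yes _   = tt
  ... | no w∉U  = w∉U w∈U

  count-member : (U : List (Vertex n)) → Unique U → count (member U) ≡ length U
  count-member []      _           = count-false n
  count-member (v ∷ U) (v∉U ∷ uU) =
    trans (count-remove (member (v ∷ U)) (member U) v (∈⇒member {v ∷ U} (here refl))
                        (All¬⇒¬Any v∉U ∘ member⇒∈) agree)
          (cong suc (count-member U uU))
    where
    agree : ∀ w → w ≢ v → member U w ≡ member (v ∷ U) w
    agree w w≢v with ≡-dec _≟ᵇ_ w v
    ... | yes w≡v = contradiction w≡v w≢v
    ... | no _    = refl

-- V₂-free families and the upper bound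

NoV2 : (Vertex n → Bool) → Set
NoV2 P = ∀ {A B C} → B ≢ C → Arc A B → Arc A C → T (P A) → T (P B) → T (P C) → ⊥

NoV2-face : {P : Vertex (suc n) → Bool} (i : Fin (suc n)) (b : Bool) → NoV2 P → NoV2 (face P i b)
NoV2-face i b noV2 B≢C A→B A→C =
  noV2 (B≢C ∘ insertAt-injective i b) (Arc-insertAt i b A→B) (Arc-insertAt i b A→C)

NoV2-member : {U : List (Vertex n)} → ¬ ContainsCopy V2 U → NoV2 (member U)
NoV2-member {n} {U} noCopy {A} {B} {C} B≢C A→B A→C A∈U B∈U C∈U =
  noCopy (f , injective , members , arcs)
  where
  f : Fin 3 → Vertex n
  f zero             = B
  f (suc zero)       = A
  f (suc (suc zero)) = C
  injective : ∀ {i j} → f i ≡ f j → i ≡ j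
  injective {zero}             {zero}             _ = refl
  injective {zero}             {suc zero}         e = contradiction (sym e) (Arc⇒≢ A→B)
  injective {zero}             {suc (suc zero)}   e = contradiction e B≢C
  injective {suc zero}         {zero}             e = contradiction e (Arc⇒≢ A→B)
  injective {suc zero}         {suc zero}         _ = refl
  injective {suc zero}         {suc (suc zero)}   e = contradiction e (Arc⇒≢ A→C)
  injective {suc (suc zero)}   {zero}             e = contradiction (sym e) B≢C
  injective {suc (suc zero)}   {suc zero}         e = contradiction (sym e) (Arc⇒≢ A→C)
  injective {suc (suc zero)}   {suc (suc zero)}   _ = refl
  members : ∀ i → f i ∈ U
  members zero             = member⇒∈ B∈U
  members (suc zero)       = member⇒∈ A∈U
  members (suc (suc zero)) = member⇒∈ C∈U
  arcs : ∀ i j → V2-arc i j → Arc (f i) (f j)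
  arcs (suc zero) zero             _ = A→B
  arcs (suc zero) (suc (suc zero)) _ = A→C

HasCoatom : (Vertex n → Bool) → Set
HasCoatom P = ∃ λ j → T (P (coatom j))

hasCoatom? : (P : Vertex n → Bool) → Dec (HasCoatom P)
hasCoatom? P = any? (λ j → T? (P (coatom j)))

CountBound : ∀ m → (Vertex (suc m) → Bool) → Set
CountBound m P = count P + 1 ≤ 2 ^ m + χ (T? (P (top (suc m)))) + χ (hasCoatom? P)

-- The lower half at i has top vertex coatom i; this is the condition under which the bounds
-- for the two halves add up to the bound for P.
GoodSplit : (Vertex (suc n) → Bool) → Fin (suc n) → Set
GoodSplit P i =
  χ (T? (P (coatom i))) + χ (hasCoatom? (face P i false)) + χ (hasCoatom? (face P i true))
    ≤ 1 + χ (hasCoatom? P)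

split-≤ : ∀ {a b p x y t z c} → a + 1 ≤ p + x + y → b + 1 ≤ p + t + z →
          x + y + z ≤ 1 + c → a + b + 1 ≤ 2 * p + t + c
split-≤ {a} {b} {p} {x} {y} {t} {z} {c} a≤ b≤ xyz≤ = +-cancelʳ-≤ 1 _ _ (begin
  a + b + 1 + 1             ≡⟨ solve (a List.∷ b List.∷ List.[]) ⟩
  (a + 1) + (b + 1)         ≤⟨ +-mono-≤ a≤ b≤ ⟩
  (p + x + y) + (p + t + z) ≡⟨ solve (p List.∷ x List.∷ y List.∷ t List.∷ z List.∷ List.[]) ⟩
  (2 * p + t) + (x + y + z) ≤⟨ +-monoʳ-≤ (2 * p + t) xyz≤ ⟩
  (2 * p + t) + (1 + c)     ≡⟨ solve (p List.∷ t List.∷ c List.∷ List.[]) ⟩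
  2 * p + t + c + 1         ∎)
  where open ≤-Reasoning

CountBound-split : ∀ {m} → (∀ Q → NoV2 Q → CountBound m Q) →
                   (P : Vertex (suc (suc m)) → Bool) (i : Fin (suc (suc m))) →
                   NoV2 P → GoodSplit P i → CountBound (suc m) P
CountBound-split {m} bound P i noV2 good =
  subst (λ c → c + 1 ≤ 2 ^ suc m + χ (T? (P (top (suc (suc m))))) + χ (hasCoatom? P))
        (sym (count-face P i)) (split-≤ {p = 2 ^ m} lower upper good)
  where
  BoundWithTop : Bool → Vertex (suc (suc m)) → Set
  BoundWithTop b v = count (face P i b) + 1 ≤ 2 ^ m + χ (T? (P v)) + χ (hasCoatom? (face P i b))
  lower : BoundWithTop false (coatom i)
  lower = subst (BoundWithTop false) (insertAt-replicate i true false) (bound _ (NoV2-face i false noV2))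
  upper : BoundWithTop true (top (suc (suc m)))
  upper = subst (BoundWithTop true) (insertAt-top i) (bound _ (NoV2-face i true noV2))

face-HasCoatom : (P : Vertex (suc n) → Bool) (i : Fin (suc n)) → HasCoatom (face P i true) → HasCoatom P
face-HasCoatom P i (j , Pj) = punchIn i j , subst (T ∘ P) (insertAt-coatom i j) Pj

lowerFace-no-coatom : {P : Vertex (suc (suc n)) → Bool} → NoV2 P → (∀ j → T (P (coatom j))) →
                      ¬ HasCoatom (face P zero false)
lowerFace-no-coatom {n} noV2 allCoatoms (j , Pj) =
  noV2 (λ ()) (zero , refl , refl) (suc j , lookup∘update j (top (suc n)) false , raise-j)
       Pj (allCoatoms (suc j)) (allCoatoms zero)
  where
  raise-j : coatom zero ≡ (false ∷ coatom j) [ suc j ]≔ true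
  raise-j = cong (false ∷_) (sym (trans ([]≔-idempotent (top (suc n)) j) (replicate-[]≔ j true)))

goodSplit : (P : Vertex (suc (suc n)) → Bool) → NoV2 P → ∃ (GoodSplit P)
goodSplit P noV2 with all? (λ j → T? (P (coatom j)))
... | yes allCoatoms = zero ,
  ≤-trans (+-mono-≤ (+-mono-≤ (χ≤1 (T? (P (coatom zero))))
                              (χ-no (lowerFace-no-coatom noV2 allCoatoms) (hasCoatom? (face P zero false))))
                    (χ≤1 (hasCoatom? (face P zero true))))
          (+-monoʳ-≤ 1 (χ-yes (zero , allCoatoms zero) (hasCoatom? P)))
... | no notAll with ¬∀⟶∃¬ _ _ (λ j → T? (P (coatom j))) notAll
...   | i , Pi∉ = i ,
  +-mono-≤ (+-mono-≤ (χ-no Pi∉ (T? (P (coatom i)))) (χ≤1 (hasCoatom? (face P i false))))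
           (χ-mono (face-HasCoatom P i) (hasCoatom? (face P i true)) (hasCoatom? P))

CountBound-Q₁ : (P : Vertex 1 → Bool) → CountBound 0 P
CountBound-Q₁ P = begin
  a + b + 1   ≡⟨ +-comm (a + b) 1 ⟩
  1 + (a + b) ≡⟨ cong suc (+-comm a b) ⟩
  1 + b + a   ≤⟨ +-monoʳ-≤ (1 + b) (χ-mono (zero ,_) (T? (P (coatom zero))) (hasCoatom? P)) ⟩
  1 + b + χ (hasCoatom? P) ∎
  where
  open ≤-Reasoning
  a b : ℕ
  a = χ (T? (P (false ∷ [])))
  b = χ (T? (P (true ∷ [])))

count-bound : ∀ m (P : Vertex (suc m) → Bool) → NoV2 P → CountBound m P
count-bound zero    P _    = CountBound-Q₁ P
count-bound (suc m) P noV2 =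
  let i , good = goodSplit P noV2 in CountBound-split (count-bound m) P i noV2 good

length-V2-free≤ : ∀ k (U : List (Vertex (suc k))) → FFree V2 U → length U ≤ 2 ^ k + 1
length-V2-free≤ k U (uniqueU , noCopy) = +-cancelʳ-≤ 1 _ _ (begin
  length U + 1             ≡⟨ cong (_+ 1) (count-member U uniqueU) ⟨
  count (member U) + 1     ≤⟨ count-bound k (member U) (NoV2-member noCopy) ⟩
  2 ^ k + χ (T? (member U (top (suc k)))) + χ (hasCoatom? (member U))
                           ≤⟨ +-mono-≤ (+-monoʳ-≤ (2 ^ k) (χ≤1 _)) (χ≤1 _) ⟩
  2 ^ k + 1 + 1            ∎)
  where open ≤-Reasoning

-- The extremal family

parityClass : ∀ n → Bool → List (Vertex n)
parityClass zero    false = [] ∷ []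
parityClass zero    true  = []
parityClass (suc n) b     = map (false ∷_) (parityClass n b) ++ map (true ∷_) (parityClass n (not b))

∈-parityClass⇒parity : ∀ n b {v} → v ∈ parityClass n b → parity v ≡ b
∈-parityClass⇒parity zero    false (here refl) = refl
∈-parityClass⇒parity (suc n) b     v∈ with ∈-++⁻ (map (false ∷_) (parityClass n b)) v∈
... | inj₁ v∈₀ with ∈-map⁻ (false ∷_) v∈₀
...   | w , w∈ , refl = ∈-parityClass⇒parity n b w∈
∈-parityClass⇒parity (suc n) b     v∈ | inj₂ v∈₁ with ∈-map⁻ (true ∷_) v∈₁
...   | w , w∈ , refl = trans (cong not (∈-parityClass⇒parity n (not b) w∈)) (not-involutive b)

parityClass-unique : ∀ n b → Unique (parityClass n b)
parityClass-unique zero    false = All.[] ∷ []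
parityClass-unique zero    true  = []
parityClass-unique (suc n) b     =
  ++⁺ (map⁺ ∷-injectiveʳ (parityClass-unique n b)) (map⁺ ∷-injectiveʳ (parityClass-unique n (not b))) disjoint
  where
  disjoint : ∀ {v} → ¬ (v ∈ map (false ∷_) (parityClass n b) × v ∈ map (true ∷_) (parityClass n (not b)))
  disjoint (v∈₀ , v∈₁) with ∈-map⁻ (false ∷_) v∈₀ | ∈-map⁻ (true ∷_) v∈₁
  ... | _ , _ , refl | _ , _ , ()

length-parityClass : ∀ n b → length (parityClass (suc n) b) ≡ 2 ^ n
length-parityClass zero    false = refl
length-parityClass zero    true  = refl
length-parityClass (suc n) b     = begin
  length (map (false ∷_) (parityClass (suc n) b) ++ map (true ∷_) (parityClass (suc n) (not b)))
    ≡⟨ length-++ (map (false ∷_) (parityClass (suc n) b)) ⟩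
  length (map (false ∷_) (parityClass (suc n) b)) + length (map (true ∷_) (parityClass (suc n) (not b)))
    ≡⟨ cong₂ _+_ (length-map (false ∷_) (parityClass (suc n) b)) (length-map (true ∷_) (parityClass (suc n) (not b))) ⟩
  length (parityClass (suc n) b) + length (parityClass (suc n) (not b))
    ≡⟨ cong₂ _+_ (length-parityClass n b) (length-parityClass n (not b)) ⟩
  2 ^ n + 2 ^ n
    ≡⟨ cong (2 ^ n +_) (+-identityʳ (2 ^ n)) ⟨
  2 ^ suc n ∎
  where open ≡-Reasoning

extremal : ∀ n → List (Vertex n)
extremal n = top n ∷ parityClass n (not (parity (top n)))

∈-extremal : ∀ {v} → v ∈ extremal n → v ≡ top n ⊎ parity v ≡ not (parity (top n))
∈-extremal     (here v≡top) = inj₁ v≡top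
∈-extremal {n} (there v∈)   = inj₂ (∈-parityClass⇒parity n _ v∈)

extremal-unique : ∀ n → Unique (extremal n)
extremal-unique n =
  All.tabulate (λ top∈ top≡ → not-¬ refl (∈-parityClass⇒parity n _ (subst (_∈ _) (sym top≡) top∈)))
  ∷ parityClass-unique n _

extremal-Arc⇒top : ∀ {A B} → A ∈ extremal n → B ∈ extremal n → Arc A B → B ≡ top n
extremal-Arc⇒top {n} A∈ B∈ A→B with ∈-extremal A∈ | ∈-extremal B∈
... | inj₁ refl | _              = contradiction A→B top-no-Arc
... | inj₂ _    | inj₁ B≡top     = B≡top
... | inj₂ pA   | inj₂ pB        =
  contradiction pB (not-¬ (trans (parity-Arc A→B) (trans (cong not pA) (not-involutive _))))

extremal-V2-free : ∀ n → ¬ ContainsCopy V2 (extremal n)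
extremal-V2-free n (f , injective , members , arcs)
  with injective (trans (toTop zero tt) (sym (toTop (suc (suc zero)) tt)))
  where
  toTop : ∀ i → V2-arc (suc zero) i → f i ≡ top n
  toTop i arc = extremal-Arc⇒top (members (suc zero)) (members i) (arcs (suc zero) i arc)
... | ()

length-extremal : ∀ k → length (extremal (suc k)) ≡ 2 ^ k + 1
length-extremal k = trans (cong suc (length-parityClass k _)) (+-comm 1 (2 ^ k))

theorem1p3 : ∀ (k : ℕ) → ExV≡ V2 (suc k) (2 ^ k + 1)
theorem1p3 k =
  (extremal (suc k) , (extremal-unique (suc k) , extremal-V2-free (suc k)) , length-extremal k) ,
  length-V2-free≤ k
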